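{- Let $n$ and $N$ be positive integers with $2n-3\ge N$, and let $\mathcal F_{n,N}$ be the family of graphs with $n$ vertices and sum index $N$. Then $\mathcal F_{n,N}$ is nonempty and $$\max\{|E(G)|: G\in\mathcal F_{n,N}\}\ge\frac{Nn}{2}-\frac{N^2}{8}-\frac{N}{4}+\epsilon$$ for some $\epsilon\ge-\frac18$ depending on $N$ and $n$; in particular, the maximum is at least $\frac{Nn}{2}-\frac{N^2}{8}-\frac{N}{4}-\frac18$.
   Context: For a finite simple graph $G=(V,E)$ and an injective map $f:V\to\mathbb Z$, let $\sigma(G,f)=\{f(v)+f(w): vw\in E\}$. The sum index of $G$ is $S(G)=\min_{f}|\sigma(G,f)|$ over all injective $f:V\to\mathbb Z$. -}

module Defs where

open import Data.Nat using (ℕ; _≤_)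
open import Data.Integer as ℤ using (ℤ)
open import Data.Fin using (Fin; _<_)
open import Data.Product using (Σ; ∃; _×_; _,_)
open import Data.List using (List; length)
open import Data.List.Relation.Unary.All using (All)
open import Data.List.Relation.Unary.Unique.Propositional using (Unique)
open import Data.List.Membership.Propositional using (_∈_)
open import Function.Bundles using (_⇔_)
open import Function.Definitions using (Injective)
open import Relation.Binary.PropositionalEquality using (_≡_)

-- A finite simple graph on vertex set Fin n: a duplicate-free list of edges,
-- each edge {i,j} recorded once as the ordered pair (i , j) with i < j
-- (so no loops, no multi-edges).
record Graph (n : ℕ) : Set where
  field
    edges   : List (Fin n × Fin n)
    ordered : All (λ e → Data.Product.proj₁ e < Data.Product.proj₂ e) edges
    nodup   : Unique edges
open Graph public

numEdges : ∀ {n} → Graph n → ℕ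
numEdges G = length (edges G)

InjLabel : ℕ → Set
InjLabel n = Σ (Fin n → ℤ) (Injective _≡_ _≡_)

InSumSet : ∀ {n} → Graph n → (Fin n → ℤ) → ℤ → Set
InSumSet G f z = ∃ λ i → ∃ λ j → ((i , j) ∈ edges G) × (f i ℤ.+ f j ≡ z)

SumSetSize : ∀ {n} → Graph n → (Fin n → ℤ) → ℕ → Set
SumSetSize G f k =
  Σ (List ℤ) λ L → Unique L × (length L ≡ k) × (∀ z → (z ∈ L) ⇔ InSumSet G f z)

SumIndex : ∀ {n} → Graph n → ℕ → Set
SumIndex {n} G N =
  (Σ (InjLabel n) λ f → SumSetSize G (Data.Product.proj₁ f) N)
  × (∀ (f : InjLabel n) (k : ℕ) → SumSetSize G (Data.Product.proj₁ f) k → N ≤ k)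

{-# OPTIONS --safe #-}
-- Label every vertex by itself and join a < b exactly when a + b lies in a fixed window of N
-- consecutive integers; the sum set is then the window, so S(G) ≤ N.  Such a graph is grown
-- from a seed on p ≈ N/2 + 2 vertices (the pairs of K_p whose sum lies in the window) by
-- repeatedly adding a new least and a new greatest vertex: the window moves up by two and
-- exactly N edges are added.  The seed is K_p minus a list X of pairs with |X| ≤ 2p − 3 − N.
-- An injective labelling x₁ < ⋯ < x_p of p vertices has the 2p − 3 distinct pair sums
-- x₁+x₂ < x₁+x₃ < x₂+x₃ < x₂+x₄ < ⋯, at most |X| of them coming from missing edges, so
-- S(G) ≥ N.  For n = p + 2k this gives |E| = kN + C(p,2) − |X|, which is the bound once the
-- seed is chosen according to the parities of N and n.
module Submission where

open import Defs
open import Data.Nat using (ℕ; _≤_; _+_; _*_; suc)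
open import Data.Integer using (ℤ; +_) renaming (_+_ to _+ℤ_; _-_ to _-ℤ_; _*_ to _*ℤ_; _≤_ to _≤ℤ_)
open import Data.Product using (Σ; _×_)

open import Data.Nat using (zero; _∸_; _<_; _≤?_; _<?_; z≤n; s≤s; z<s; s<s; NonZero; >-nonZero)
open import Data.Nat.Properties
open import Data.Nat.Combinatorics using (_C_; nC1≡n; nCk+nC[k+1]≡[n+1]C[k+1])
open import Data.Nat.DivMod using (_mod_; m<n⇒m%n≡m)
open import Data.Nat.Tactic.RingSolver using (solve-∀)
open import Data.Integer using (-_; +≤+) renaming (_<_ to _<ℤ_)
import Data.Integer.Properties as ℤP
import Data.Integer.Tactic.RingSolver as ℤSolver
open import Data.Fin as Fin using (Fin; toℕ)
open import Data.Fin.Properties using (toℕ-fromℕ<; toℕ-injective)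
open import Data.List using (List; []; _∷_; _++_; length; map; filter; upTo)
open import Data.List.Properties using (length-++; length-map; length-upTo)
open import Data.List.Membership.Propositional using (_∈_)
open import Data.List.Membership.Propositional.Properties
  using (∈-∃++; ∈-++⁻; ∈-++⁺ˡ; ∈-++⁺ʳ; ∈-map⁺; ∈-map⁻; ∈-upTo⁺; ∈-upTo⁻; ∈-filter⁺; ∈-filter⁻)
open import Data.List.Relation.Binary.Subset.Propositional using (_⊆_)
open import Data.List.Relation.Binary.Permutation.Propositional using (↭-sym; ↭⇒↭ₛ)
open import Data.List.Relation.Binary.Permutation.Propositional.Properties using (↭-length; ∈-resp-↭)
import Data.List.Relation.Binary.Permutation.Setoid.Properties as Perm
open import Data.List.Relation.Unary.Any using (here; there)
open import Data.List.Relation.Unary.All as All using (All; _∷_)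
import Data.List.Relation.Unary.All.Properties as All
open import Data.List.Relation.Unary.AllPairs as AllPairs using ([]; _∷_)
open import Data.List.Relation.Unary.Linked using (Linked; []; [-]; _∷_)
open import Data.List.Relation.Unary.Linked.Properties using (Linked⇒AllPairs)
open import Data.List.Relation.Unary.Unique.Propositional using (Unique)
import Data.List.Relation.Unary.Unique.Propositional.Properties as Unique
open import Data.List.Sort ℤP.≤-decTotalOrder using (sort; sort-↭; sort-↗)
open import Data.Product as Product using (∃; ∃₂; _,_; proj₁; proj₂)
open import Data.Sum as Sum using (_⊎_; inj₁; inj₂)
open import Data.Empty using (⊥-elim)
open import Function.Bundles using (mk⇔; module Equivalence)
open import Relation.Binary.Definitions using (tri<; tri≈; tri>)
open import Relation.Binary.PropositionalEquality
open import Relation.Nullary using (¬_; yes; no)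
open import Relation.Nullary.Decidable using (_×-dec_)
open import Relation.Unary using (Decidable)

module _ {A : Set} where

  length-map-upTo : ∀ (f : ℕ → A) m → length (map f (upTo m)) ≡ m
  length-map-upTo f m = trans (length-map f (upTo m)) (length-upTo m)

  Unique-⊆⇒length≤ : {xs ys : List A} → Unique xs → xs ⊆ ys → length xs ≤ length ys
  Unique-⊆⇒length≤ {[]} _ _ = z≤n
  Unique-⊆⇒length≤ {x ∷ xs} (x∉xs ∷ xs!) x∷xs⊆ys
    with as , bs , refl ← ∈-∃++ (x∷xs⊆ys (here refl)) = begin
      suc (length xs)             ≤⟨ s≤s (Unique-⊆⇒length≤ xs! xs⊆as++bs) ⟩
      suc (length (as ++ bs))     ≡⟨ cong suc (length-++ as) ⟩
      suc (length as + length bs) ≡⟨ +-suc (length as) (length bs) ⟨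
      length as + suc (length bs) ≡⟨ length-++ as ⟨
      length (as ++ x ∷ bs)       ∎
    where
    open ≤-Reasoning
    xs⊆as++bs : xs ⊆ as ++ bs
    xs⊆as++bs y∈xs with ∈-++⁻ as (x∷xs⊆ys (there y∈xs))
    ... | inj₁ y∈as         = ∈-++⁺ˡ y∈as
    ... | inj₂ (here refl)  = ⊥-elim (All.lookup x∉xs y∈xs refl)
    ... | inj₂ (there y∈bs) = ∈-++⁺ʳ as y∈bs

  map⁺-injectiveOn : {B : Set} {f : A → B} {xs : List A} →
    (∀ {x y} → x ∈ xs → y ∈ xs → f x ≡ f y → x ≡ y) → Unique xs → Unique (map f xs)
  map⁺-injectiveOn _ [] = []
  map⁺-injectiveOn f-inj (x∉xs ∷ xs!) =
    All.map⁺ (All.tabulate λ y∈xs fx≡fy → All.lookup x∉xs y∈xs (f-inj (here refl) (there y∈xs) fx≡fy))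
    ∷ map⁺-injectiveOn (λ x∈ y∈ → f-inj (there x∈) (there y∈)) xs!

sort-strict : (xs : List ℤ) → Unique xs →
  ∃ λ ys → Linked _<ℤ_ ys × length ys ≡ length xs × ys ⊆ xs
sort-strict xs xs! = sort xs , strict (sort-↗ xs) sorted! , ↭-length (sort-↭ xs) , ∈-resp-↭ (sort-↭ xs)
  where
  sorted! : Unique (sort xs)
  sorted! = Perm.Unique-resp-↭ (setoid ℤ) (↭⇒↭ₛ (↭-sym (sort-↭ xs))) xs!
  strict : ∀ {ys} → Linked _≤ℤ_ ys → Unique ys → Linked _<ℤ_ ys
  strict []               _                = []
  strict [-]              _                = [-]
  strict (x≤y ∷ ys↗) ((x≢y ∷ _) ∷ ys!) = ℤP.≤∧≢⇒< x≤y x≢y ∷ strict ys↗ ys!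

zigzag : ℤ → List ℤ → List ℤ
zigzag x []           = []
zigzag x (y ∷ [])     = x +ℤ y ∷ []
zigzag x (y ∷ z ∷ zs) = x +ℤ y ∷ x +ℤ z ∷ zigzag y (z ∷ zs)

length-zigzag : ∀ x y ys → length (zigzag x (y ∷ ys)) ≡ suc (2 * length ys)
length-zigzag x y []       = refl
length-zigzag x y (z ∷ zs) =
  trans (cong (_+_ 2) (length-zigzag y z zs)) (cong suc (sym (*-suc 2 (length zs))))

zigzag-increasing : ∀ {x y ys} → Linked _<ℤ_ (x ∷ y ∷ ys) → Linked _<ℤ_ (zigzag x (y ∷ ys))
zigzag-increasing {ys = []}              _                  = [-]
zigzag-increasing {x} {y} {z ∷ []}     (x<y ∷ y<z ∷ _)    =
  ℤP.+-monoʳ-< x y<z ∷ ℤP.+-monoˡ-< z x<y ∷ [-]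
zigzag-increasing {x} {y} {z ∷ _ ∷ _} (x<y ∷ y<z ∷ zs↗) =
  ℤP.+-monoʳ-< x y<z ∷ ℤP.+-monoˡ-< z x<y ∷ zigzag-increasing (y<z ∷ zs↗)

zigzag-sums : ∀ {x y ys s} → Linked _<ℤ_ (x ∷ y ∷ ys) → s ∈ zigzag x (y ∷ ys) →
  ∃₂ λ a b → a ∈ x ∷ y ∷ ys × b ∈ x ∷ y ∷ ys × a <ℤ b × s ≡ a +ℤ b
zigzag-sums {ys = []}    (x<y ∷ _) (here refl) = _ , _ , here refl , there (here refl) , x<y , refl
zigzag-sums {ys = _ ∷ _} (x<y ∷ _) (here refl) = _ , _ , here refl , there (here refl) , x<y , refl
zigzag-sums {ys = _ ∷ _} (x<y ∷ y<z ∷ _) (there (here refl)) =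
  _ , _ , here refl , there (there (here refl)) , ℤP.<-trans x<y y<z , refl
zigzag-sums {ys = _ ∷ _} (_ ∷ ys↗) (there (there s∈))
  with a , b , a∈ , b∈ , a<b , s≡ ← zigzag-sums ys↗ s∈ = a , b , there a∈ , there b∈ , a<b , s≡

pairSums-lowerBound : {xs L : List ℤ} → Unique xs →
  (∀ {x y} → x ∈ xs → y ∈ xs → x ≢ y → x +ℤ y ∈ L) → 2 * length xs ≤ 3 + length L
pairSums-lowerBound {xs} {L} xs! sums∈L
  with ys , ys↗ , |ys|≡|xs| , ys⊆xs ← sort-strict xs xs!
  rewrite sym |ys|≡|xs| = bound ys ys↗ ys⊆xs
  where
  bound : ∀ ys → Linked _<ℤ_ ys → ys ⊆ xs → 2 * length ys ≤ 3 + length L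
  bound []           _   _     = z≤n
  bound (_ ∷ [])     _   _     = s≤s (s≤s z≤n)
  bound (x ∷ y ∷ ys) ys↗ ys⊆xs = begin
    2 * (2 + length ys)                   ≡⟨ arith (length ys) ⟩
    3 + suc (2 * length ys)               ≡⟨ cong (_+_ 3) (length-zigzag x y ys) ⟨
    3 + length (zigzag x (y ∷ ys))        ≤⟨ +-monoʳ-≤ 3 (Unique-⊆⇒length≤ zigzag! zigzag⊆L) ⟩
    3 + length L                          ∎
    where
    open ≤-Reasoning
    arith : ∀ l → 2 * (2 + l) ≡ 3 + suc (2 * l)
    arith = solve-∀
    zigzag! : Unique (zigzag x (y ∷ ys))
    zigzag! = AllPairs.map ℤP.<⇒≢ (Linked⇒AllPairs ℤP.<-trans (zigzag-increasing ys↗))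
    zigzag⊆L : zigzag x (y ∷ ys) ⊆ L
    zigzag⊆L s∈ with a , b , a∈ , b∈ , a<b , refl ← zigzag-sums ys↗ s∈ =
      sums∈L (ys⊆xs a∈) (ys⊆xs b∈) (ℤP.<⇒≢ a<b)

SumWithin : ℕ → ℕ → ℕ × ℕ → Set
SumWithin s N (a , b) = s ≤ a + b × a + b < s + N

sumWithin? : ∀ s N → Decidable (SumWithin s N)
sumWithin? s N (a , b) = s ≤? a + b ×-dec a + b <? s + N

record EdgeList (n : ℕ) : Set where
  field
    pairs   : List (ℕ × ℕ)
    unique  : Unique pairs
    bounded : ∀ {a b} → (a , b) ∈ pairs → a < b × b < n
open EdgeList

idLabel : ∀ {n} → Fin n → ℤ
idLabel v = + toℕ v

idLabel-injective : ∀ {n} {u v : Fin n} → idLabel u ≡ idLabel v → u ≡ v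
idLabel-injective eq = toℕ-injective (ℤP.+-injective eq)

module _ {n : ℕ} .{{_ : NonZero n}} where

  vertex : ℕ → Fin n
  vertex a = a mod n

  toℕ-vertex : ∀ {a} → a < n → toℕ (vertex a) ≡ a
  toℕ-vertex a<n = trans (toℕ-fromℕ< _) (m<n⇒m%n≡m a<n)

  vertex-injectiveBelow : ∀ {a b} → a < n → b < n → vertex a ≡ vertex b → a ≡ b
  vertex-injectiveBelow a<n b<n eq =
    trans (sym (toℕ-vertex a<n)) (trans (cong toℕ eq) (toℕ-vertex b<n))

  vertexPair : ℕ × ℕ → Fin n × Fin n
  vertexPair (a , b) = vertex a , vertex b

  toGraph : EdgeList n → Graph n
  toGraph E = record { edges = map vertexPair (pairs E) ; ordered = increasing ; nodup = distinct }
    where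
    increasing : All (λ e → proj₁ e Fin.< proj₂ e) (map vertexPair (pairs E))
    increasing = All.map⁺ (All.tabulate λ { {a , b} ab∈ → let a<b , b<n = bounded E ab∈ in
      subst₂ _<_ (sym (toℕ-vertex (<-trans a<b b<n))) (sym (toℕ-vertex b<n)) a<b })
    distinct : Unique (map vertexPair (pairs E))
    distinct = map⁺-injectiveOn injective (unique E)
      where
      injective : ∀ {e e′} → e ∈ pairs E → e′ ∈ pairs E → vertexPair e ≡ vertexPair e′ → e ≡ e′
      injective {a , b} {c , d} ab∈ cd∈ eq =
        let a<b , b<n = bounded E ab∈ ; c<d , d<n = bounded E cd∈ in
        cong₂ _,_ (vertex-injectiveBelow (<-trans a<b b<n) (<-trans c<d d<n) (cong proj₁ eq))
                  (vertex-injectiveBelow b<n d<n (cong proj₂ eq))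

  module _ (E : EdgeList n) (f : Fin n → ℤ) where

    inSumSet⁺ : ∀ {a b} → (a , b) ∈ pairs E → InSumSet (toGraph E) f (f (vertex a) +ℤ f (vertex b))
    inSumSet⁺ ab∈ = _ , _ , ∈-map⁺ vertexPair ab∈ , refl

    inSumSet⁻ : ∀ {z} → InSumSet (toGraph E) f z →
      ∃₂ λ a b → (a , b) ∈ pairs E × f (vertex a) +ℤ f (vertex b) ≡ z
    inSumSet⁻ (_ , _ , e∈ , refl) with (a , b) , ab∈ , refl ← ∈-map⁻ vertexPair e∈ = a , b , ab∈ , refl

  sumSetSize-interval : (E : EdgeList n) (s N : ℕ) →
    (∀ {a b} → (a , b) ∈ pairs E → SumWithin s N (a , b)) →
    (∀ {i} → i < N → ∃₂ λ a b → (a , b) ∈ pairs E × a + b ≡ s + i) →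
    SumSetSize (toGraph E) idLabel N
  sumSetSize-interval E s N within realized =
    L , L! , length-map-upTo _ N , λ z → mk⇔ to from
    where
    L : List ℤ
    L = map (λ i → + (s + i)) (upTo N)
    L! : Unique L
    L! = Unique.map⁺ (λ eq → +-cancelˡ-≡ s _ _ (ℤP.+-injective eq)) (Unique.upTo⁺ N)
    label-sum : ∀ {a b} → (a , b) ∈ pairs E →
      idLabel (vertex a) +ℤ idLabel (vertex b) ≡ + (a + b)
    label-sum ab∈ = let a<b , b<n = bounded E ab∈ in
      cong +_ (cong₂ _+_ (toℕ-vertex (<-trans a<b b<n)) (toℕ-vertex b<n))
    to : ∀ {z} → z ∈ L → InSumSet (toGraph E) idLabel z
    to z∈ with i , i∈ , refl ← ∈-map⁻ _ z∈
         with a , b , ab∈ , a+b≡s+i ← realized (∈-upTo⁻ i∈) =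
      subst (InSumSet (toGraph E) idLabel) (trans (label-sum ab∈) (cong +_ a+b≡s+i))
            (inSumSet⁺ E idLabel ab∈)
    from : ∀ {z} → InSumSet (toGraph E) idLabel z → z ∈ L
    from z∈σ with a , b , ab∈ , refl ← inSumSet⁻ E idLabel z∈σ
      with s≤a+b , a+b<s+N ← within ab∈ rewrite label-sum ab∈ =
      subst (λ t → + t ∈ L) (m+[n∸m]≡n s≤a+b)
        (∈-map⁺ _ (∈-upTo⁺ (+-cancelˡ-< s _ _ (subst (_< s + N) (sym (m+[n∸m]≡n s≤a+b)) a+b<s+N))))

  nearClique-sumSetSize : (E : EdgeList n) (c p : ℕ) → c + p ≤ n → (X : List (ℕ × ℕ)) →
    (∀ {a b} → a < b → b < p → (c + a , c + b) ∈ pairs E ⊎ (a , b) ∈ X) →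
    (f : InjLabel n) {m : ℕ} → SumSetSize (toGraph E) (proj₁ f) m → 2 * p ≤ 3 + (m + length X)
  nearClique-sumSetSize E c p c+p≤n X covered (f , f-inj) (L , _ , refl , L⇔σ) =
    subst₂ _≤_ (cong (2 *_) (length-map-upTo g p))
               (cong (_+_ 3) (trans (length-++ L) (cong (_+_ (length L)) (length-map _ X))))
               (pairSums-lowerBound window! sums∈)
    where
    g : ℕ → ℤ
    g a = f (vertex (c + a))
    inWindow : ∀ {a} → a ∈ upTo p → c + a < n
    inWindow a∈ = <-≤-trans (+-monoʳ-< c (∈-upTo⁻ a∈)) c+p≤n
    window! : Unique (map g (upTo p))
    window! = map⁺-injectiveOn
      (λ a∈ b∈ eq → +-cancelˡ-≡ c _ _ (vertex-injectiveBelow (inWindow a∈) (inWindow b∈) (f-inj eq)))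
      (Unique.upTo⁺ p)
    missing : List ℤ
    missing = map (λ (a , b) → g a +ℤ g b) X
    pairSum∈ : ∀ {a b} → a < b → b < p → g a +ℤ g b ∈ L ++ missing
    pairSum∈ a<b b<p with covered a<b b<p
    ... | inj₁ e∈ = ∈-++⁺ˡ (Equivalence.from (L⇔σ _) (inSumSet⁺ E f e∈))
    ... | inj₂ x∈ = ∈-++⁺ʳ L (∈-map⁺ _ x∈)
    sums∈ : ∀ {x y} → x ∈ map g (upTo p) → y ∈ map g (upTo p) → x ≢ y → x +ℤ y ∈ L ++ missing
    sums∈ x∈ y∈ x≢y with a , a∈ , refl ← ∈-map⁻ g x∈ | b , b∈ , refl ← ∈-map⁻ g y∈ | <-cmp a b
    ... | tri< a<b _ _  = pairSum∈ a<b (∈-upTo⁻ b∈)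
    ... | tri≈ _ refl _ = ⊥-elim (x≢y refl)
    ... | tri> _ _ b<a  = subst (_∈ L ++ missing) (ℤP.+-comm (g b) (g a)) (pairSum∈ b<a (∈-upTo⁻ a∈))

pairsBelow : ℕ → List (ℕ × ℕ)
pairsBelow zero    = []
pairsBelow (suc p) = pairsBelow p ++ map (_, p) (upTo p)

∈-pairsBelow⁻ : ∀ {p a b} → (a , b) ∈ pairsBelow p → a < b × b < p
∈-pairsBelow⁻ {suc p} ab∈ with ∈-++⁻ (pairsBelow p) ab∈
... | inj₁ ab∈′ = let a<b , b<p = ∈-pairsBelow⁻ ab∈′ in a<b , m<n⇒m<1+n b<p
... | inj₂ ab∈′ with _ , a∈ , refl ← ∈-map⁻ (_, p) ab∈′ = ∈-upTo⁻ a∈ , ≤-refl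

∈-pairsBelow⁺ : ∀ {p a b} → a < b → b < p → (a , b) ∈ pairsBelow p
∈-pairsBelow⁺ {suc p} {b = b} a<b b<1+p with b <? p
... | yes b<p = ∈-++⁺ˡ (∈-pairsBelow⁺ a<b b<p)
... | no  b≮p with refl ← ≤-antisym (≤-pred b<1+p) (≮⇒≥ b≮p) =
  ∈-++⁺ʳ (pairsBelow p) (∈-map⁺ (_, p) (∈-upTo⁺ a<b))

pairsBelow-unique : ∀ p → Unique (pairsBelow p)
pairsBelow-unique zero    = []
pairsBelow-unique (suc p) =
  Unique.++⁺ (pairsBelow-unique p) (Unique.map⁺ (cong proj₁) (Unique.upTo⁺ p)) disjoint
  where
  disjoint : ∀ {e} → ¬ (e ∈ pairsBelow p × e ∈ map (_, p) (upTo p))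
  disjoint (e∈ , e∈′) with _ , _ , refl ← ∈-map⁻ (_, p) e∈′ = <-irrefl refl (proj₂ (∈-pairsBelow⁻ e∈))

[1+n]C2≡nC2+n : ∀ n → suc n C 2 ≡ n C 2 + n
[1+n]C2≡nC2+n n = begin
  suc n C 2     ≡⟨ nCk+nC[k+1]≡[n+1]C[k+1] n 1 ⟨
  n C 1 + n C 2 ≡⟨ cong (_+ n C 2) (nC1≡n n) ⟩
  n + n C 2     ≡⟨ +-comm n (n C 2) ⟩
  n C 2 + n     ∎
  where open ≡-Reasoning

length-pairsBelow : ∀ p → length (pairsBelow p) ≡ p C 2
length-pairsBelow zero    = refl
length-pairsBelow (suc p) = begin
  length (pairsBelow p ++ map (_, p) (upTo p))
    ≡⟨ length-++ (pairsBelow p) ⟩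
  length (pairsBelow p) + length (map (_, p) (upTo p))
    ≡⟨ cong₂ _+_ (length-pairsBelow p) (length-map-upTo _ p) ⟩
  p C 2 + p
    ≡⟨ [1+n]C2≡nC2+n p ⟨
  suc p C 2 ∎
  where open ≡-Reasoning

square-suc : ∀ n → n * n + 2 * n + 1 ≡ suc n * suc n
square-suc = solve-∀

2*nC2+n≡n*n : ∀ n → 2 * (n C 2) + n ≡ n * n
2*nC2+n≡n*n zero    = refl
2*nC2+n≡n*n (suc n) = begin
  2 * (suc n C 2) + suc n         ≡⟨ cong (λ c → 2 * c + suc n) ([1+n]C2≡nC2+n n) ⟩
  2 * (n C 2 + n) + suc n         ≡⟨ rearrange (n C 2) n ⟩
  (2 * (n C 2) + n) + 2 * n + 1   ≡⟨ cong (λ m → m + 2 * n + 1) (2*nC2+n≡n*n n) ⟩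
  n * n + 2 * n + 1               ≡⟨ square-suc n ⟩
  suc n * suc n                   ∎
  where
  open ≡-Reasoning
  rearrange : ∀ c n → 2 * (c + n) + suc n ≡ (2 * c + n) + 2 * n + 1
  rearrange = solve-∀

pairSum-surjective : ∀ {p s} → 1 ≤ s → 2 + s < p + p → ∃₂ λ a b → a < b × b < p × a + b ≡ s
pairSum-surjective {p} {s} 1≤s _ with s <? p
... | yes s<p = 0 , s , 1≤s , s<p , refl
pairSum-surjective {suc q} {s} _ 2+s<2p | no s≮p =
  s ∸ q , q , +-cancelʳ-< q (s ∸ q) q (subst (_< q + q) (sym s∸q+q≡s) s<q+q) , ≤-refl , s∸q+q≡s
  where
  s∸q+q≡s : s ∸ q + q ≡ s
  s∸q+q≡s = m∸n+n≡m (≤-trans (n≤1+n q) (≮⇒≥ s≮p))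
  s<q+q : s < q + q
  s<q+q = ≤-pred (≤-pred (subst (2 + s <_) (cong suc (+-suc q q)) 2+s<2p))

pairSum-≥1 : ∀ {a b} → a < b → 1 ≤ a + b
pairSum-≥1 {a} {b} a<b = ≤-trans (≤-trans (s≤s z≤n) a<b) (m≤n+m b a)

pairSum-≥2-unless : ∀ {a b} → a < b → 2 ≤ a + b ⊎ (a , b) ≡ (0 , 1)
pairSum-≥2-unless {zero}  {suc zero}    _   = inj₂ refl
pairSum-≥2-unless {zero}  {suc (suc b)} _   = inj₁ (s≤s (s≤s z≤n))
pairSum-≥2-unless {suc a} {b}           a<b =
  inj₁ (≤-trans (≤-trans (s≤s (s≤s z≤n)) a<b) (m≤n+m b (suc a)))

pairSum-≤ : ∀ {a b t} → a < b → b ≤ 1 + t → a + b ≤ 1 + (t + t)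
pairSum-≤ {t = t} a<b b≤1+t =
  ≤-trans (+-mono-≤ (≤-pred (≤-trans a<b b≤1+t)) b≤1+t) (≤-reflexive (+-suc t t))

pairSum-≤-unless : ∀ {a b t} → a < b → b ≤ 2 + t → a + b ≤ 2 + (t + t) ⊎ (a , b) ≡ (1 + t , 2 + t)
pairSum-≤-unless {a} {b} {t} a<b b≤2+t with b ≤? 1 + t
... | yes b≤1+t = inj₁ (m≤n⇒m≤1+n (pairSum-≤ a<b b≤1+t))
... | no  b≰1+t with refl ← ≤-antisym b≤2+t (≰⇒> b≰1+t) with a ≤? t
...   | yes a≤t = inj₁ (≤-trans (+-monoˡ-≤ (2 + t) a≤t) (≤-reflexive (arith t)))
  where
  arith : ∀ t → t + (2 + t) ≡ 2 + (t + t)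
  arith = solve-∀
...   | no  a≰t with refl ← ≤-antisym (≤-pred a<b) (≰⇒> a≰t) = inj₂ refl

pairSum-≤-unless₂ : ∀ {a b t} → a < b → b ≤ 3 + t →
  a + b ≤ 3 + (t + t) ⊎ (a , b) ≡ (1 + t , 3 + t) ⊎ (a , b) ≡ (2 + t , 3 + t)
pairSum-≤-unless₂ {a} {b} {t} a<b b≤3+t with b ≤? 2 + t
... | yes b≤2+t = inj₁ (≤-trans (+-mono-≤ (≤-pred (≤-trans a<b b≤2+t)) b≤2+t) (≤-reflexive (arith t)))
  where
  arith : ∀ t → 1 + t + (2 + t) ≡ 3 + (t + t)
  arith = solve-∀
... | no  b≰2+t with refl ← ≤-antisym b≤3+t (≰⇒> b≰2+t) with a ≤? t
...   | yes a≤t = inj₁ (≤-trans (+-monoˡ-≤ (3 + t) a≤t) (≤-reflexive (arith t)))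
  where
  arith : ∀ t → t + (3 + t) ≡ 3 + (t + t)
  arith = solve-∀
...   | no  a≰t with a ≤? 1 + t
...     | yes a≤1+t with refl ← ≤-antisym a≤1+t (≰⇒> a≰t) = inj₂ (inj₁ refl)
...     | no  a≰1+t with refl ← ≤-antisym (≤-pred a<b) (≰⇒> a≰1+t) = inj₂ (inj₂ refl)

DenseSumGraph : ℕ → ℕ → Set
DenseSumGraph n N = Σ (Graph n) λ G → SumIndex G N ×
  ((+ (4 * N * n)) -ℤ (+ (N * N)) -ℤ (+ (2 * N)) -ℤ (+ 1) ≤ℤ (+ (8 * numEdges G)))

sumWithin-shift : ∀ {s N a b} → SumWithin s N (a , b) → SumWithin (2 + s) N (suc a , suc b)
sumWithin-shift {s} {N} {a} {b} (s≤a+b , a+b<s+N) =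
  subst (2 + s ≤_) 2+a+b≡1+a+1+b (s≤s (s≤s s≤a+b)) ,
  subst (_< 2 + s + N) 2+a+b≡1+a+1+b (s<s (s<s a+b<s+N))
  where
  2+a+b≡1+a+1+b : 2 + (a + b) ≡ suc a + suc b
  2+a+b≡1+a+1+b = cong suc (sym (+-suc a b))

edgeBudget : ∀ {N p k E x} → k * N + p C 2 ≤ E + x →
  4 * N * p + 8 * x ≤ 8 * (p C 2) + suc N * suc N → 4 * N * (p + (k + k)) ≤ 8 * E + suc N * suc N
edgeBudget {N} {p} {k} {E} {x} count budget = +-cancelʳ-≤ (8 * x) _ _ (begin
  4 * N * (p + (k + k)) + 8 * x          ≡⟨ e₁ N p k x ⟩
  (4 * N * p + 8 * x) + 8 * (k * N)      ≤⟨ +-monoˡ-≤ (8 * (k * N)) budget ⟩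
  8 * (p C 2) + Q + 8 * (k * N)          ≡⟨ e₂ (p C 2) Q (k * N) ⟩
  8 * (k * N + p C 2) + Q                ≤⟨ +-monoˡ-≤ Q (*-monoʳ-≤ 8 count) ⟩
  8 * (E + x) + Q                        ≡⟨ e₃ E x Q ⟩
  8 * E + Q + 8 * x                      ∎)
  where
  open ≤-Reasoning
  Q = suc N * suc N
  e₁ : ∀ N p k x → 4 * N * (p + (k + k)) + 8 * x ≡ (4 * N * p + 8 * x) + 8 * (k * N)
  e₁ = solve-∀
  e₂ : ∀ c Q m → 8 * c + Q + 8 * m ≡ 8 * (m + c) + Q
  e₂ = solve-∀
  e₃ : ∀ E x Q → 8 * (E + x) + Q ≡ 8 * E + Q + 8 * x
  e₃ = solve-∀

ℤ-edgeBound : ∀ {N n E} → 4 * N * n ≤ 8 * E + suc N * suc N →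
  (+ (4 * N * n)) -ℤ (+ (N * N)) -ℤ (+ (2 * N)) -ℤ (+ 1) ≤ℤ (+ (8 * E))
ℤ-edgeBound {N} {n} {E} bound = begin
  + (4 * N * n) -ℤ + (N * N) -ℤ + (2 * N) -ℤ + 1
    ≡⟨ regroup (+ (4 * N * n)) (+ (N * N)) (+ (2 * N)) (+ 1) ⟩
  + (4 * N * n) -ℤ + (N * N + 2 * N + 1)
    ≡⟨ cong (λ q → + (4 * N * n) -ℤ + q) (square-suc N) ⟩
  + (4 * N * n) -ℤ + Q
    ≤⟨ ℤP.+-monoˡ-≤ (- + Q) (+≤+ bound) ⟩
  + (8 * E) +ℤ + Q -ℤ + Q
    ≡⟨ cancel (+ (8 * E)) (+ Q) ⟩
  + (8 * E) ∎
  where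
  open ℤP.≤-Reasoning
  Q = suc N * suc N
  regroup : ∀ a b c d → a -ℤ b -ℤ c -ℤ d ≡ a -ℤ (b +ℤ c +ℤ d)
  regroup = ℤSolver.solve-∀
  cancel : ∀ a b → a +ℤ b -ℤ b ≡ a
  cancel = ℤSolver.solve-∀

-- lo is the least sum of the seed's window; passing from layer k to layer k + 1 shifts every
-- vertex up by one and adds a new vertex 0 with cL neighbours and a new top vertex with cR.
module Layered (lo cL cR : ℕ) (lo-pos : 1 ≤ lo) (2+cR≤p : 2 + cR ≤ lo + cL) where

  p N : ℕ
  p = lo + cL
  N = cL + cR

  base : List (ℕ × ℕ)
  base = filter (sumWithin? lo N) (pairsBelow p)

  start size : ℕ → ℕ
  start zero    = lo
  start (suc k) = 2 + start k
  size zero    = p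
  size (suc k) = 2 + size k

  shift : ℕ × ℕ → ℕ × ℕ
  shift = Product.map suc suc

  bottomStar topStar layer : ℕ → List (ℕ × ℕ)
  bottomStar k = map (λ i → 0 , 2 + (start k + i)) (upTo cL)
  topStar    k = map (λ i → suc i , suc (size k)) (upTo cR)
  layer zero    = base
  layer (suc k) = bottomStar k ++ topStar k ++ map shift (layer k)

  start+cL≡size : ∀ k → start k + cL ≡ size k
  start+cL≡size zero    = refl
  start+cL≡size (suc k) = cong (λ m → 2 + m) (start+cL≡size k)

  window≤size : ∀ k → k + p ≤ size k
  window≤size zero    = ≤-refl
  window≤size (suc k) = s≤s (m≤n⇒m≤1+n (window≤size k))

  p≤size : ∀ k → p ≤ size k
  p≤size k = ≤-trans (m≤n+m p k) (window≤size k)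

  size≡p+2k : ∀ k → size k ≡ p + (k + k)
  size≡p+2k zero    = sym (+-identityʳ p)
  size≡p+2k (suc k) = trans (cong (λ m → 2 + m) (size≡p+2k k)) (arith p k)
    where
    arith : ∀ p k → 2 + (p + (k + k)) ≡ p + (suc k + suc k)
    arith = solve-∀

  LayerEdge : ℕ → ℕ × ℕ → Set
  LayerEdge k (a , b) = a < b × b < size k × SumWithin (start k) N (a , b)

  bottomStar-edge : ∀ k {a b} → (a , b) ∈ bottomStar k → LayerEdge (suc k) (a , b)
  bottomStar-edge k ab∈ with i , i∈ , refl ← ∈-map⁻ _ ab∈ =
    z<s ,
    s<s (s<s (subst (start k + i <_) (start+cL≡size k) (+-monoʳ-< (start k) i<cL))) ,
    s≤s (s≤s (m≤m+n (start k) i)) ,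
    s<s (s<s (+-monoʳ-< (start k) (≤-trans i<cL (m≤m+n cL cR))))
    where
    i<cL = ∈-upTo⁻ i∈

  topStar-edge : ∀ k {a b} → (a , b) ∈ topStar k → LayerEdge (suc k) (a , b)
  topStar-edge k ab∈ with i , i∈ , refl ← ∈-map⁻ _ ab∈ =
    s<s (<-≤-trans i<cR (≤-trans (≤-trans (m≤n+m cR 2) 2+cR≤p) (p≤size k))) ,
    s<s (n<1+n (size k)) ,
    sumWithin-shift (start≤ , <start+N)
    where
    i<cR = ∈-upTo⁻ i∈
    i+size≡ : i + size k ≡ start k + cL + i
    i+size≡ = trans (+-comm i (size k)) (cong (_+ i) (sym (start+cL≡size k)))
    start≤ : start k ≤ i + size k
    start≤ = subst (start k ≤_) (sym i+size≡) (≤-trans (m≤m+n (start k) cL) (m≤m+n _ i))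
    <start+N : i + size k < start k + N
    <start+N = subst₂ _<_ (sym i+size≡) (+-assoc (start k) cL cR) (+-monoʳ-< (start k + cL) i<cR)

  layer-edge : ∀ k {a b} → (a , b) ∈ layer k → LayerEdge k (a , b)
  layer-edge zero ab∈ with ab∈pairs , within ← ∈-filter⁻ (sumWithin? lo N) ab∈ =
    let a<b , b<p = ∈-pairsBelow⁻ ab∈pairs in a<b , b<p , within
  layer-edge (suc k) ab∈ with ∈-++⁻ (bottomStar k) ab∈
  ... | inj₁ ab∈bottom = bottomStar-edge k ab∈bottom
  ... | inj₂ ab∈rest with ∈-++⁻ (topStar k) ab∈rest
  ...   | inj₁ ab∈top = topStar-edge k ab∈top
  ...   | inj₂ ab∈shifted with _ , ab∈′ , refl ← ∈-map⁻ shift ab∈shifted =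
    let a<b , b<size , within = layer-edge k ab∈′ in
    s<s a<b , s<s (m<n⇒m<1+n b<size) , sumWithin-shift within

  layer-unique : ∀ k → Unique (layer k)
  layer-unique zero    = Unique.filter⁺ (sumWithin? lo N) (pairsBelow-unique p)
  layer-unique (suc k) =
    Unique.++⁺ bottom! (Unique.++⁺ top! shifted! top#shifted) bottom#rest
    where
    bottom! : Unique (bottomStar k)
    bottom! = Unique.map⁺
      (λ eq → +-cancelˡ-≡ (start k) _ _ (suc-injective (suc-injective (cong proj₂ eq))))
      (Unique.upTo⁺ cL)
    top! : Unique (topStar k)
    top! = Unique.map⁺ (λ eq → suc-injective (cong proj₁ eq)) (Unique.upTo⁺ cR)
    shifted! : Unique (map shift (layer k))
    shifted! = Unique.map⁺
      (λ eq → cong₂ _,_ (suc-injective (cong proj₁ eq)) (suc-injective (cong proj₂ eq)))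
      (layer-unique k)
    top#shifted : ∀ {e} → ¬ (e ∈ topStar k × e ∈ map shift (layer k))
    top#shifted (e∈top , e∈shifted) with _ , _ , refl ← ∈-map⁻ _ e∈top
                                     with _ , ab∈ , refl ← ∈-map⁻ shift e∈shifted =
      <-irrefl refl (proj₁ (proj₂ (layer-edge k ab∈)))
    bottom#rest : ∀ {e} → ¬ (e ∈ bottomStar k × e ∈ topStar k ++ map shift (layer k))
    bottom#rest (e∈bottom , e∈rest) with _ , _ , refl ← ∈-map⁻ _ e∈bottom
                                    with ∈-++⁻ (topStar k) e∈rest
    ... | inj₁ e∈top     with () ← ∈-map⁻ _ e∈top
    ... | inj₂ e∈shifted with () ← ∈-map⁻ shift e∈shifted

  length-layer : ∀ k → length (layer k) ≡ k * N + length base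
  length-layer zero    = refl
  length-layer (suc k) = begin
    length (bottomStar k ++ topStar k ++ map shift (layer k))
      ≡⟨ length-++ (bottomStar k) ⟩
    length (bottomStar k) + length (topStar k ++ map shift (layer k))
      ≡⟨ cong (_+_ (length (bottomStar k))) (length-++ (topStar k)) ⟩
    length (bottomStar k) + (length (topStar k) + length (map shift (layer k)))
      ≡⟨ cong₂ (λ l m → l + (m + length (map shift (layer k))))
               (length-map-upTo _ cL) (length-map-upTo _ cR) ⟩
    cL + (cR + length (map shift (layer k)))
      ≡⟨ cong (λ l → cL + (cR + l)) (trans (length-map shift (layer k)) (length-layer k)) ⟩
    cL + (cR + (k * N + length base))
      ≡⟨ +-assoc cL cR _ ⟨
    N + (k * N + length base)
      ≡⟨ +-assoc N (k * N) _ ⟨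
    suc k * N + length base ∎
    where open ≡-Reasoning

  shift-base∈layer : ∀ k {a b} → (a , b) ∈ base → (k + a , k + b) ∈ layer k
  shift-base∈layer zero    ab∈ = ab∈
  shift-base∈layer (suc k) ab∈ =
    ∈-++⁺ʳ (bottomStar k) (∈-++⁺ʳ (topStar k) (∈-map⁺ shift (shift-base∈layer k ab∈)))

  2+lo+i<2p : ∀ {i} → i < N → 2 + (lo + i) < p + p
  2+lo+i<2p i<N =
    <-≤-trans (+-monoʳ-< (2 + lo) i<N) (subst (_≤ p + p) (arith lo cL cR) (+-monoʳ-≤ p 2+cR≤p))
    where
    arith : ∀ lo cL cR → lo + cL + (2 + cR) ≡ 2 + (lo + (cL + cR))
    arith = solve-∀

  layer-realizes : ∀ k {i} → i < N → ∃₂ λ a b → (a , b) ∈ layer k × a + b ≡ start k + i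
  layer-realizes zero {i} i<N
    with a , b , a<b , b<p , a+b≡ ← pairSum-surjective {p} (≤-trans lo-pos (m≤m+n lo i)) (2+lo+i<2p i<N)
    =
    a , b , ∈-filter⁺ (sumWithin? lo N) (∈-pairsBelow⁺ a<b b<p) within , a+b≡
    where
    within : SumWithin lo N (a , b)
    within = subst (lo ≤_) (sym a+b≡) (m≤m+n lo i) , subst (_< lo + N) (sym a+b≡) (+-monoʳ-< lo i<N)
  layer-realizes (suc k) i<N with a , b , ab∈ , a+b≡ ← layer-realizes k i<N =
    suc a , suc b , ∈-++⁺ʳ (bottomStar k) (∈-++⁺ʳ (topStar k) (∈-map⁺ shift ab∈)) ,
    trans (cong suc (+-suc a b)) (cong (λ m → 2 + m) a+b≡)

  layerEdges : ∀ k → EdgeList (size k)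
  layerEdges k = record
    { pairs   = layer k
    ; unique  = layer-unique k
    ; bounded = λ ab∈ → let a<b , b<size , _ = layer-edge k ab∈ in a<b , b<size
    }

  size-nonZero : ∀ k → NonZero (size k)
  size-nonZero k = >-nonZero (≤-trans (≤-trans (s≤s z≤n) 2+cR≤p) (p≤size k))

  layerGraph : ∀ k → Graph (size k)
  layerGraph k = toGraph {{size-nonZero k}} (layerEdges k)

  module _ (X : List (ℕ × ℕ))
           (covered : ∀ {a b} → a < b → b < p → SumWithin lo N (a , b) ⊎ (a , b) ∈ X) where

    base-covered : ∀ {a b} → a < b → b < p → (a , b) ∈ base ⊎ (a , b) ∈ X
    base-covered a<b b<p =
      Sum.map₁ (∈-filter⁺ (sumWithin? lo N) (∈-pairsBelow⁺ a<b b<p)) (covered a<b b<p)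

    sumIndex-layerGraph : N + length X + 3 ≤ 2 * p → ∀ k → SumIndex (layerGraph k) N
    sumIndex-layerGraph forcing k = ((idLabel , idLabel-injective) , upper) , lower
      where
      upper : SumSetSize (layerGraph k) idLabel N
      upper = sumSetSize-interval {{size-nonZero k}} (layerEdges k) (start k) N
                (λ ab∈ → proj₂ (proj₂ (layer-edge k ab∈))) (layer-realizes k)
      window-covered : ∀ {a b} → a < b → b < p → (k + a , k + b) ∈ layer k ⊎ (a , b) ∈ X
      window-covered a<b b<p = Sum.map₁ (shift-base∈layer k) (base-covered a<b b<p)
      lower : ∀ f m → SumSetSize (layerGraph k) (proj₁ f) m → N ≤ m
      lower f m σf = +-cancelʳ-≤ (length X + 3) N m (begin
        N + (length X + 3)  ≡⟨ +-assoc N (length X) 3 ⟨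
        N + length X + 3    ≤⟨ forcing ⟩
        2 * p               ≤⟨ nearClique-sumSetSize {{size-nonZero k}} (layerEdges k) k p
                                 (window≤size k) X window-covered f σf ⟩
        3 + (m + length X)  ≡⟨ arith m (length X) ⟩
        m + (length X + 3)  ∎)
        where
        open ≤-Reasoning
        arith : ∀ m x → 3 + (m + x) ≡ m + (x + 3)
        arith = solve-∀

    numEdges-layerGraph : ∀ k → k * N + p C 2 ≤ numEdges (layerGraph k) + length X
    numEdges-layerGraph k = begin
      k * N + p C 2                      ≡⟨ cong (_+_ (k * N)) (length-pairsBelow p) ⟨
      k * N + length (pairsBelow p)      ≤⟨ +-monoʳ-≤ (k * N) pairsBelow≤base++X ⟩
      k * N + length (base ++ X)         ≡⟨ cong (_+_ (k * N)) (length-++ base) ⟩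
      k * N + (length base + length X)   ≡⟨ +-assoc (k * N) (length base) (length X) ⟨
      k * N + length base + length X     ≡⟨ cong (_+ length X) (length-layer k) ⟨
      length (layer k) + length X        ≡⟨ cong (_+ length X) (length-map _ (layer k)) ⟨
      numEdges (layerGraph k) + length X ∎
      where
      open ≤-Reasoning
      pairsBelow⊆base++X : pairsBelow p ⊆ base ++ X
      pairsBelow⊆base++X {a , b} ab∈ = let a<b , b<p = ∈-pairsBelow⁻ ab∈ in
        Sum.[ ∈-++⁺ˡ , ∈-++⁺ʳ base ] (base-covered a<b b<p)
      pairsBelow≤base++X : length (pairsBelow p) ≤ length (base ++ X)
      pairsBelow≤base++X = Unique-⊆⇒length≤ (pairsBelow-unique p) pairsBelow⊆base++X

    denseGraphs : N + length X + 3 ≤ 2 * p →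
      4 * N * p + 8 * length X ≤ 8 * (p C 2) + suc N * suc N → ∀ k → DenseSumGraph (p + (k + k)) N
    denseGraphs forcing budget k = subst (λ n → DenseSumGraph n N) (size≡p+2k k)
      (layerGraph k , sumIndex-layerGraph forcing k , ℤ-edgeBound {N} {size k} {E} bound)
      where
      E = numEdges (layerGraph k)
      bound : 4 * N * size k ≤ 8 * E + suc N * suc N
      bound = subst (λ n → 4 * N * n ≤ 8 * E + suc N * suc N) (sym (size≡p+2k k))
                (edgeBudget {N} {p} {k} {E} {length X} (numEdges-layerGraph k) budget)

budget-from-square : ∀ {a b} p c → a + c + 4 * p ≡ 4 * (p * p) + b → a ≤ 8 * (p C 2) + b
budget-from-square {a} {b} p c eq = +-cancelʳ-≤ (4 * p) a (8 * (p C 2) + b) (begin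
  a + 4 * p                   ≤⟨ +-monoˡ-≤ (4 * p) (m≤m+n a c) ⟩
  a + c + 4 * p               ≡⟨ eq ⟩
  4 * (p * p) + b             ≡⟨ cong (λ m → 4 * m + b) (2*nC2+n≡n*n p) ⟨
  4 * (2 * (p C 2) + p) + b   ≡⟨ arith (p C 2) p b ⟩
  8 * (p C 2) + b + 4 * p     ∎)
  where
  open ≤-Reasoning
  arith : ∀ c p b → 4 * (2 * c + p) + b ≡ 8 * c + b + 4 * p
  arith = solve-∀

Family : ℕ → ℕ → Set
Family N p = ∀ k → DenseSumGraph (p + (k + k)) N

oddFamily : ∀ t → Family (suc (t + t)) (2 + t)
oddFamily t = Layered.denseGraphs 1 (suc t) t (s≤s z≤n) ≤-refl [] covered
  (≤-reflexive (forcing t)) (budget-from-square (2 + t) 4 (budget t))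
  where
  covered : ∀ {a b} → a < b → b < 2 + t → SumWithin 1 (suc (t + t)) (a , b) ⊎ (a , b) ∈ []
  covered a<b b<p = inj₁ (pairSum-≥1 a<b , s≤s (pairSum-≤ a<b (≤-pred b<p)))
  forcing : ∀ t → suc (t + t) + 0 + 3 ≡ 2 * (2 + t)
  forcing = solve-∀
  budget : ∀ t → 4 * suc (t + t) * (2 + t) + 8 * 0 + 4 + 4 * (2 + t)
               ≡ 4 * ((2 + t) * (2 + t)) + suc (suc (t + t)) * suc (suc (t + t))
  budget = solve-∀

oddFamily⁺ : ∀ t → Family (suc (t + t)) (3 + t)
oddFamily⁺ t = Layered.denseGraphs 2 (suc t) t (s≤s z≤n) (n≤1+n _) X covered
  (≤-reflexive (forcing t)) (budget-from-square (3 + t) 0 (budget t))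
  where
  X : List (ℕ × ℕ)
  X = (0 , 1) ∷ (1 + t , 2 + t) ∷ []
  covered : ∀ {a b} → a < b → b < 3 + t → SumWithin 2 (suc (t + t)) (a , b) ⊎ (a , b) ∈ X
  covered a<b b<p with pairSum-≥2-unless a<b | pairSum-≤-unless a<b (≤-pred b<p)
  ... | inj₂ refl | _         = inj₂ (here refl)
  ... | inj₁ 2≤   | inj₁ ≤top = inj₁ (2≤ , s≤s ≤top)
  ... | inj₁ _    | inj₂ refl = inj₂ (there (here refl))
  forcing : ∀ t → suc (t + t) + 2 + 3 ≡ 2 * (3 + t)
  forcing = solve-∀
  budget : ∀ t → 4 * suc (t + t) * (3 + t) + 8 * 2 + 0 + 4 * (3 + t)
               ≡ 4 * ((3 + t) * (3 + t)) + suc (suc (t + t)) * suc (suc (t + t))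
  budget = solve-∀

evenFamily : ∀ t → Family (2 + (t + t)) (3 + t)
evenFamily t = Layered.denseGraphs 1 (2 + t) t (s≤s z≤n) (n≤1+n _) X covered
  (≤-reflexive (forcing t)) (budget-from-square (3 + t) 1 (budget t))
  where
  X : List (ℕ × ℕ)
  X = (1 + t , 2 + t) ∷ []
  covered : ∀ {a b} → a < b → b < 3 + t → SumWithin 1 (2 + (t + t)) (a , b) ⊎ (a , b) ∈ X
  covered a<b b<p with pairSum-≤-unless a<b (≤-pred b<p)
  ... | inj₁ ≤top = inj₁ (pairSum-≥1 a<b , s≤s ≤top)
  ... | inj₂ refl = inj₂ (here refl)
  forcing : ∀ t → 2 + (t + t) + 1 + 3 ≡ 2 * (3 + t)
  forcing = solve-∀
  budget : ∀ t → 4 * (2 + (t + t)) * (3 + t) + 8 * 1 + 1 + 4 * (3 + t)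
               ≡ 4 * ((3 + t) * (3 + t)) + (3 + (t + t)) * (3 + (t + t))
  budget = solve-∀

evenFamily⁺ : ∀ t → Family (2 + (t + t)) (4 + t)
evenFamily⁺ t = Layered.denseGraphs 2 (2 + t) t (s≤s z≤n) (≤-trans (n≤1+n _) (n≤1+n _)) X covered
  (≤-reflexive (forcing t)) (budget-from-square (4 + t) 1 (budget t))
  where
  X : List (ℕ × ℕ)
  X = (0 , 1) ∷ (1 + t , 3 + t) ∷ (2 + t , 3 + t) ∷ []
  covered : ∀ {a b} → a < b → b < 4 + t → SumWithin 2 (2 + (t + t)) (a , b) ⊎ (a , b) ∈ X
  covered a<b b<p with pairSum-≥2-unless a<b | pairSum-≤-unless₂ a<b (≤-pred b<p)
  ... | inj₂ refl | _                = inj₂ (here refl)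
  ... | inj₁ 2≤   | inj₁ ≤top        = inj₁ (2≤ , s≤s ≤top)
  ... | inj₁ _    | inj₂ (inj₁ refl) = inj₂ (there (here refl))
  ... | inj₁ _    | inj₂ (inj₂ refl) = inj₂ (there (there (here refl)))
  forcing : ∀ t → 2 + (t + t) + 3 + 3 ≡ 2 * (4 + t)
  forcing = solve-∀
  budget : ∀ t → 4 * (2 + (t + t)) * (4 + t) + 8 * 3 + 1 + 4 * (4 + t)
               ≡ 4 * ((4 + t) * (4 + t)) + (3 + (t + t)) * (3 + (t + t))
  budget = solve-∀

halve : ∀ m → ∃ λ k → m ≡ k + k ⊎ m ≡ suc (k + k)
halve zero = 0 , inj₁ refl
halve (suc m) with halve m
... | k , inj₁ m≡2k   = k , inj₂ (cong suc m≡2k)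
... | k , inj₂ m≡2k+1 = suc k , inj₁ (cong suc (trans m≡2k+1 (sym (+-suc k k))))

2*m≤1+2*n⇒m≤n : ∀ {m n} → 2 * m ≤ suc (2 * n) → m ≤ n
2*m≤1+2*n⇒m≤n {m} {n} 2m≤1+2n = ≮⇒≥ λ n<m →
  <-irrefl refl (≤-trans (≤-trans (≤-reflexive (sym (*-suc 2 n))) (*-monoʳ-≤ 2 n<m)) 2m≤1+2n)

consecutiveFamilies : ∀ N → 1 ≤ N →
  ∃ λ p → (∀ {n} → N + 3 ≤ 2 * n → p ≤ n) × Family N p × Family N (suc p)
consecutiveFamilies (suc M) _ with halve M
... | t , inj₁ refl = 2 + t , (λ {n} h → 2*m≤1+2*n⇒m≤n (≤-trans (≤-reflexive (arith t)) (m≤n⇒m≤1+n h)))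
                      , oddFamily t , oddFamily⁺ t
  where
  arith : ∀ t → 2 * (2 + t) ≡ suc (t + t) + 3
  arith = solve-∀
... | t , inj₂ refl = 3 + t , (λ {n} h → 2*m≤1+2*n⇒m≤n (≤-trans (≤-reflexive (arith t)) (s≤s h)))
                      , evenFamily t , evenFamily⁺ t
  where
  arith : ∀ t → 2 * (3 + t) ≡ suc (suc (suc (t + t)) + 3)
  arith = solve-∀

theorem3p5 : (n N : ℕ) → 1 ≤ n → 1 ≤ N → N + 3 ≤ 2 * n →
    Σ (Graph n) λ G → SumIndex G N ×
    ((+ (4 * N * n)) -ℤ (+ (N * N)) -ℤ (+ (2 * N)) -ℤ (+ 1) ≤ℤ (+ (8 * numEdges G)))
-- 1 ≤ n is implied by N + 3 ≤ 2 * n.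
theorem3p5 n N _ 1≤N N+3≤2n with p , p≤n , family , family⁺ ← consecutiveFamilies N 1≤N
  with d , refl ← m≤n⇒∃[o]m+o≡n (p≤n {n} N+3≤2n) with halve d
... | k , inj₁ refl = family k
... | k , inj₂ refl = subst (λ n → DenseSumGraph n N) (sym (+-suc p (k + k))) (family⁺ k)
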